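{- Let $t\ge 2$ be an integer and let $G=(V,E)$ be a finite connected graph that is not a cycle and that contains no path $v_1,\dots,v_t$ of $t$ vertices in which every $v_i$ has degree exactly two in $G$. Then $|E|\ge \left(1+\frac{1}{4t}\right)(d_2+d_{\ge 3})$, where $d_2$ is the number of vertices of degree exactly $2$ and $d_{\ge3}$ the number of vertices of degree at least $3$ in $G$. -}

module Defs where

open import Data.Nat using (ℕ; zero; suc; _+_; _*_; _≤_; _≡ᵇ_; _≤ᵇ_)
open import Data.Bool using (Bool; true; false; if_then_else_; _∧_; T)
open import Data.Fin using (Fin; toℕ; _<?_)
open import Data.List using (List; map; allFin)
open import Data.Nat.ListAction using (sum)
open import Data.Product using (Σ; _×_)
open import Relation.Nullary using (¬_; does)
open import Relation.Binary.PropositionalEquality using (_≡_)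
open import Function.Definitions using (Injective)

record Graph (n : ℕ) : Set where
  field
    adj    : Fin n → Fin n → Bool
    sym    : ∀ i j → adj i j ≡ adj j i
    irrefl : ∀ i → adj i i ≡ false
open Graph public

bit : Bool → ℕ
bit b = if b then 1 else 0

module _ {n : ℕ} (G : Graph n) where

  degree : Fin n → ℕ
  degree v = sum (map (λ u → bit (adj G v u)) (allFin n))

  edgeCount : ℕ
  edgeCount = sum (map (λ i → sum (map (λ j → bit (adj G i j ∧ does (i <? j)))
                                        (allFin n))) (allFin n))

  d2 : ℕ
  d2 = sum (map (λ v → bit (degree v ≡ᵇ 2)) (allFin n))

  d≥3 : ℕ
  d≥3 = sum (map (λ v → bit (3 ≤ᵇ degree v)) (allFin n))

  data Walk : Fin n → Fin n → Set where
    here : ∀ {u} → Walk u u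
    step : ∀ {u w v} → T (adj G u w) → Walk w v → Walk u v

  Connected : Set
  Connected = ∀ u v → Walk u v

  IsCycle : Set
  IsCycle = Connected × (∀ v → degree v ≡ 2)

  HasDeg2Path : ℕ → Set
  HasDeg2Path t = Σ (Fin t → Fin n) λ f →
    Injective _≡_ _≡_ f
    × (∀ (i j : Fin t) → toℕ j ≡ suc (toℕ i) → T (adj G (f i) (f j)))
    × (∀ i → degree (f i) ≡ 2)

-- Orient every edge both ways. An arc (v , u) out of a vertex v of degree 2
-- extends to a non-backtracking trail v = y₀, u = y₁, y₂, … that keeps going
-- as long as it sits on vertices of degree 2. If its first t vertices all had
-- degree 2, then either they are distinct (a forbidden path) or the trail
-- returns to y₀ and G is a cycle. So it reaches a vertex w of degree ≠ 2
-- within t − 1 steps, and retracing it from w recovers (v , u). Hence the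
-- 2 d₂ arcs out of degree-2 vertices are covered by the first t − 1 arcs of
-- the trails starting at the arcs out of the other vertices, whose number
-- a = Σ_{deg w ≠ 2} deg w satisfies 3 d_{≥3} ≤ a and 2|E| = 2 d₂ + a.
-- The bound follows from 2 d₂ ≤ (t − 1) a by linear arithmetic.
module Submission where

open import Defs renaming (sym to adj-sym)
open import Data.Bool using (Bool; true; false; not; _∧_; T; if_then_else_)
open import Data.Bool.Properties using (T-∧; T-≡)
open import Data.Empty using (⊥-elim)
open import Data.Fin using (Fin; toℕ; punchIn; punchOut; _<?_) renaming (zero to fzero; suc to fsuc)
open import Data.Fin.Properties
  using (_≟_; any?; toℕ<n; <-cmp; punchInᵢ≢i; punchIn-punchOut; punchOut-injective)
open import Data.List using (List; []; _∷_; map; allFin; tabulate; applyUpTo; length)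
open import Data.List.Membership.Propositional using (_∈_)
open import Data.List.Membership.Propositional.Properties using (∈-applyUpTo⁺)
open import Data.List.Properties using (map-tabulate; length-applyUpTo)
open import Data.List.Relation.Unary.Any using (here; there)
open import Data.Nat
  using (ℕ; zero; suc; _+_; _*_; _≤_; _<_; z≤n; s≤s; z<s; _≡ᵇ_; _≤ᵇ_)
open import Data.Nat.GeneralisedArithmetic using (iterate)
import Data.Nat.ListAction as List
open import Data.Nat.Properties hiding (<-cmp; _<?_) renaming (_≟_ to _≟ℕ_)
open import Data.Nat.Tactic.RingSolver using (solve-∀)
open import Data.Product using (∃₂; ∃-syntax; _×_; _,_; proj₁; proj₂; swap)
open import Data.Product.Properties using (≡-dec)
open import Data.Sum using (_⊎_; inj₁; inj₂; [_,_]′)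
open import Function using (_∘_; id; Equivalence)
open import Relation.Binary using (tri<; tri≈; tri>; DecidableEquality)
open import Relation.Binary.PropositionalEquality
open import Relation.Nullary using (¬_; Dec; yes; no; does; contradiction)
open import Relation.Nullary.Decidable using (T?; _×-dec_; ¬?; decidable-stable; dec-true; dec-false)
open import Relation.Unary using (Decidable)

open import Algebra.Properties.Semiring.Sum +-*-semiring
  using (sum; sum-syntax; ∑-distrib-+; ∑-comm; *-distribˡ-sum; sum-cong-≗; sum-remove; sum-replicate-zero)

listSum-allFin : ∀ {n} (f : Fin n → ℕ) → List.sum (map f (allFin n)) ≡ ∑[ i < n ] f i
listSum-allFin {n} f = trans (cong List.sum (map-tabulate id f)) (sum-tabulate f)
  where
  sum-tabulate : ∀ {m} (g : Fin m → ℕ) → List.sum (tabulate g) ≡ sum g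
  sum-tabulate {zero}  g = refl
  sum-tabulate {suc m} g = cong (g fzero +_) (sum-tabulate (g ∘ fsuc))

∑-mono-≤ : ∀ {n} {f g : Fin n → ℕ} → (∀ i → f i ≤ g i) → sum f ≤ sum g
∑-mono-≤ {zero}  f≤g = z≤n
∑-mono-≤ {suc n} f≤g = +-mono-≤ (f≤g fzero) (∑-mono-≤ (f≤g ∘ fsuc))

∑-zero : ∀ {n} (f : Fin n → ℕ) → (∀ i → f i ≡ 0) → sum f ≡ 0
∑-zero {n} f f≡0 = trans (sum-cong-≗ f≡0) (sum-replicate-zero n)

∑-punchIn : ∀ {n} (f : Fin (suc n) → ℕ) a → sum f ≡ f a + ∑[ j < n ] f (punchIn a j)
∑-punchIn f a = sum-remove {i = a} f

∑-single : ∀ {n} (f : Fin n → ℕ) a → (∀ i → i ≢ a → f i ≡ 0) → sum f ≡ f a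
∑-single {suc n} f a rest = begin
  sum f                             ≡⟨ ∑-punchIn f a ⟩
  f a + ∑[ j < n ] f (punchIn a j)  ≡⟨ cong (f a +_) (∑-zero _ (λ j → rest _ (punchInᵢ≢i a j))) ⟩
  f a + 0                           ≡⟨ +-identityʳ (f a) ⟩
  f a                               ∎
  where open ≡-Reasoning

term≤∑ : ∀ {n} (f : Fin n → ℕ) a → f a ≤ sum f
term≤∑ {suc n} f a = subst (f a ≤_) (sym (∑-punchIn f a)) (m≤m+n _ _)

pair≤∑ : ∀ {n} (f : Fin n → ℕ) {a b} → a ≢ b → f a + f b ≤ sum f
pair≤∑ {suc n} f {a} {b} a≢b = begin
  f a + f b                          ≡⟨ cong (λ i → f a + f i) (sym (punchIn-punchOut a≢b)) ⟩
  f a + f (punchIn a (punchOut a≢b)) ≤⟨ +-monoʳ-≤ (f a) (term≤∑ (f ∘ punchIn a) (punchOut a≢b)) ⟩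
  f a + ∑[ j < n ] f (punchIn a j)   ≡⟨ sym (∑-punchIn f a) ⟩
  sum f                              ∎
  where open ≤-Reasoning

triple≤∑ : ∀ {n} (f : Fin n → ℕ) {a b c} → a ≢ b → a ≢ c → b ≢ c → f a + f b + f c ≤ sum f
triple≤∑ {suc n} f {a} {b} {c} a≢b a≢c b≢c = begin
  f a + f b + f c                    ≡⟨ +-assoc (f a) (f b) (f c) ⟩
  f a + (f b + f c)                  ≡⟨ cong₂ (λ i j → f a + (f i + f j))
                                          (sym (punchIn-punchOut a≢b)) (sym (punchIn-punchOut a≢c)) ⟩
  f a + (f (punchIn a (punchOut a≢b)) + f (punchIn a (punchOut a≢c)))
                                     ≤⟨ +-monoʳ-≤ (f a)
                                          (pair≤∑ (f ∘ punchIn a) (b≢c ∘ punchOut-injective a≢b a≢c)) ⟩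
  f a + ∑[ j < n ] f (punchIn a j)   ≡⟨ sym (∑-punchIn f a) ⟩
  sum f                              ∎
  where open ≤-Reasoning

∑∑-∑∑-comm : ∀ {m n} (g : Fin m → Fin m → Fin n → Fin n → ℕ) →
  ∑[ v < m ] ∑[ u < m ] ∑[ w < n ] ∑[ x < n ] g v u w x ≡
  ∑[ w < n ] ∑[ x < n ] ∑[ v < m ] ∑[ u < m ] g v u w x
∑∑-∑∑-comm {m} {n} g = begin
  ∑[ v < m ] ∑[ u < m ] ∑[ w < n ] ∑[ x < n ] g v u w x
    ≡⟨ sum-cong-≗ (λ v → ∑-comm (λ u w → ∑[ x < n ] g v u w x)) ⟩
  ∑[ v < m ] ∑[ w < n ] ∑[ u < m ] ∑[ x < n ] g v u w x
    ≡⟨ ∑-comm (λ v w → ∑[ u < m ] ∑[ x < n ] g v u w x) ⟩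
  ∑[ w < n ] ∑[ v < m ] ∑[ u < m ] ∑[ x < n ] g v u w x
    ≡⟨ sum-cong-≗ (λ w → sum-cong-≗ (λ v → ∑-comm (λ u x → g v u w x))) ⟩
  ∑[ w < n ] ∑[ v < m ] ∑[ x < n ] ∑[ u < m ] g v u w x
    ≡⟨ sum-cong-≗ (λ w → ∑-comm (λ v x → ∑[ u < m ] g v u w x)) ⟩
  ∑[ w < n ] ∑[ x < n ] ∑[ v < m ] ∑[ u < m ] g v u w x ∎
  where open ≡-Reasoning

module _ {P : ℕ → Set} (P? : Decidable P) where

  all<-or-least-failure : ∀ t →
    (∀ m → m < t → P m) ⊎ ∃[ m ] (m < t × (∀ k → k < m → P k) × ¬ P m)
  all<-or-least-failure zero = inj₁ (λ _ ())
  all<-or-least-failure (suc t) with all<-or-least-failure t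
  ... | inj₂ (m , m<t , below , ¬Pm) = inj₂ (m , m<n⇒m<1+n m<t , below , ¬Pm)
  ... | inj₁ below with P? t
  ...   | no ¬Pt = inj₂ (t , n<1+n t , below , ¬Pt)
  ...   | yes Pt = inj₁ λ m m<1+t → [ below m , (λ { refl → Pt }) ]′ (m<1+n⇒m<n∨m≡n m<1+t)

  all<? : ∀ t → Dec (∀ m → m < t → P m)
  all<? t with all<-or-least-failure t
  ... | inj₁ all = yes all
  ... | inj₂ (m , m<t , _ , ¬Pm) = no λ all → ¬Pm (all m m<t)

DistinctBelow : ∀ {A : Set} → (ℕ → A) → ℕ → Set
DistinctBelow y t = ∀ {i j} → i < j → j < t → y i ≢ y j

first-repetition : ∀ {A : Set} → DecidableEquality A → (y : ℕ → A) (t : ℕ) →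
  DistinctBelow y t ⊎ ∃₂ λ j i → i < j × j < t × DistinctBelow y j × y i ≡ y j
first-repetition _≟ᴬ_ y t with all<-or-least-failure (λ j → all<? (λ i → ¬? (y i ≟ᴬ y j)) j) t
... | inj₁ all-new = inj₁ λ i<j j<t → all-new _ j<t _ i<j
... | inj₂ (j , j<t , new-below , ¬new) with all<-or-least-failure (λ i → ¬? (y i ≟ᴬ y j)) j
...   | inj₁ new = contradiction new ¬new
...   | inj₂ (i , i<j , _ , ¬¬yi≡yj) =
  inj₂ (j , i , i<j , j<t , (λ i<k k<j → new-below _ k<j _ i<k) , decidable-stable (y i ≟ᴬ y j) ¬¬yi≡yj)

-- Double counting

bit≤1 : ∀ b → bit b ≤ 1
bit≤1 true  = s≤s z≤n
bit≤1 false = z≤n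

bit-T : ∀ {b} → T b → bit b ≡ 1
bit-T {true} _ = refl

bit-∧ : ∀ b c → bit (b ∧ c) ≡ bit b * bit c
bit-∧ true  c = sym (+-identityʳ (bit c))
bit-∧ false c = refl

bit-does-yes : ∀ {P : Set} (P? : Dec P) → P → bit (does P?) ≡ 1
bit-does-yes P? p = cong bit (dec-true P? p)

bit-does-no : ∀ {P : Set} (P? : Dec P) → ¬ P → bit (does P?) ≡ 0
bit-does-no P? ¬p = cong bit (dec-false P? ¬p)

bit-≡ᵇ2-* : ∀ d → bit (d ≡ᵇ 2) * d ≡ 2 * bit (d ≡ᵇ 2)
bit-≡ᵇ2-* 0                   = refl
bit-≡ᵇ2-* 1                   = refl
bit-≡ᵇ2-* 2                   = refl
bit-≡ᵇ2-* (suc (suc (suc d))) = refl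

3*bit-3≤ᵇ≤ : ∀ d → 3 * bit (3 ≤ᵇ d) ≤ bit (not (d ≡ᵇ 2)) * d
3*bit-3≤ᵇ≤ 0                   = z≤n
3*bit-3≤ᵇ≤ 1                   = z≤n
3*bit-3≤ᵇ≤ 2                   = z≤n
3*bit-3≤ᵇ≤ (suc (suc (suc d))) = s≤s (s≤s (s≤s z≤n))

bit-*-split : ∀ b d → d ≡ bit b * d + bit (not b) * d
bit-*-split true  d = sym (trans (+-identityʳ _) (*-identityˡ d))
bit-*-split false d = sym (*-identityˡ d)

module _ {A : Set} (_≟ᴬ_ : DecidableEquality A) where

  multiplicity : A → List A → ℕ
  multiplicity a []       = 0
  multiplicity a (b ∷ bs) = bit (does (b ≟ᴬ a)) + multiplicity a bs

  ∈⇒1≤multiplicity : ∀ {a bs} → a ∈ bs → 1 ≤ multiplicity a bs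
  ∈⇒1≤multiplicity {a} {_ ∷ bs} (here refl) =
    subst (λ k → 1 ≤ k + multiplicity a bs) (sym (bit-does-yes (a ≟ᴬ a) refl)) (s≤s z≤n)
  ∈⇒1≤multiplicity {a} {b ∷ _} (there a∈bs) = ≤-trans (∈⇒1≤multiplicity a∈bs) (m≤n+m _ _)

module _ {m : ℕ} where

  _≟²_ : DecidableEquality (Fin m × Fin m)
  _≟²_ = ≡-dec _≟_ _≟_

  ∑∑-indicator : ∀ b → ∑[ v < m ] ∑[ u < m ] bit (does (b ≟² (v , u))) ≡ 1
  ∑∑-indicator (a , c) = begin
    ∑[ v < m ] ∑[ u < m ] bit (does ((a , c) ≟² (v , u)))
      ≡⟨ ∑-single (λ v → ∑[ u < m ] bit (does ((a , c) ≟² (v , u)))) a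
           (λ v v≢a → ∑-zero _ (λ u → bit-does-no ((a , c) ≟² (v , u)) (v≢a ∘ sym ∘ cong proj₁))) ⟩
    ∑[ u < m ] bit (does ((a , c) ≟² (a , u)))
      ≡⟨ ∑-single (λ u → bit (does ((a , c) ≟² (a , u)))) c
           (λ u u≢c → bit-does-no ((a , c) ≟² (a , u)) (u≢c ∘ sym ∘ cong proj₂)) ⟩
    bit (does ((a , c) ≟² (a , c)))
      ≡⟨ bit-does-yes ((a , c) ≟² (a , c)) refl ⟩
    1 ∎
    where open ≡-Reasoning

  ∑∑-multiplicity : ∀ bs → ∑[ v < m ] ∑[ u < m ] multiplicity _≟²_ (v , u) bs ≡ length bs
  ∑∑-multiplicity []       = ∑-zero {m} (λ v → ∑[ u < m ] 0) (λ v → ∑-zero {m} (λ u → 0) (λ u → refl))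
  ∑∑-multiplicity (b ∷ bs) = begin
    ∑[ v < m ] ∑[ u < m ] (bit (does (b ≟² (v , u))) + multiplicity _≟²_ (v , u) bs)
      ≡⟨ sum-cong-≗ (λ v → ∑-distrib-+ (λ u → bit (does (b ≟² (v , u)))) (λ u → multiplicity _≟²_ (v , u) bs)) ⟩
    ∑[ v < m ] (∑[ u < m ] bit (does (b ≟² (v , u))) + ∑[ u < m ] multiplicity _≟²_ (v , u) bs)
      ≡⟨ ∑-distrib-+ (λ v → ∑[ u < m ] bit (does (b ≟² (v , u)))) (λ v → ∑[ u < m ] multiplicity _≟²_ (v , u) bs) ⟩
    ∑[ v < m ] ∑[ u < m ] bit (does (b ≟² (v , u))) + ∑[ v < m ] ∑[ u < m ] multiplicity _≟²_ (v , u) bs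
      ≡⟨ cong₂ _+_ (∑∑-indicator b) (∑∑-multiplicity bs) ⟩
    suc (length bs) ∎
    where open ≡-Reasoning

  double-counting : (P : Fin m → Fin m → Bool) (L : Fin m → Fin m → List (Fin m × Fin m)) →
    (∀ v u → T (P v u) → ∃₂ λ w x → (v , u) ∈ L w x) →
    ∑[ v < m ] ∑[ u < m ] bit (P v u) ≤ ∑[ w < m ] ∑[ x < m ] length (L w x)
  double-counting P L covered = begin
    ∑[ v < m ] ∑[ u < m ] bit (P v u)
      ≤⟨ ∑-mono-≤ (λ v → ∑-mono-≤ (bit≤multiplicities v)) ⟩
    ∑[ v < m ] ∑[ u < m ] ∑[ w < m ] ∑[ x < m ] multiplicity _≟²_ (v , u) (L w x)
      ≡⟨ ∑∑-∑∑-comm (λ v u w x → multiplicity _≟²_ (v , u) (L w x)) ⟩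
    ∑[ w < m ] ∑[ x < m ] ∑[ v < m ] ∑[ u < m ] multiplicity _≟²_ (v , u) (L w x)
      ≡⟨ sum-cong-≗ (λ w → sum-cong-≗ (λ x → ∑∑-multiplicity (L w x))) ⟩
    ∑[ w < m ] ∑[ x < m ] length (L w x) ∎
    where
    open ≤-Reasoning
    bit≤multiplicities : ∀ v u → bit (P v u) ≤ ∑[ w < m ] ∑[ x < m ] multiplicity _≟²_ (v , u) (L w x)
    bit≤multiplicities v u with P v u in Pvu
    ... | false = z≤n
    ... | true with covered v u (Equivalence.from T-≡ Pvu)
    ...   | w , x , vu∈L = begin
      1                                                         ≤⟨ ∈⇒1≤multiplicity _≟²_ vu∈L ⟩
      multiplicity _≟²_ (v , u) (L w x)                         ≤⟨ term≤∑ (λ x → multiplicity _≟²_ (v , u) (L w x)) x ⟩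
      ∑[ x < m ] multiplicity _≟²_ (v , u) (L w x)              ≤⟨ term≤∑ (λ w → ∑[ x < m ] multiplicity _≟²_ (v , u) (L w x)) w ⟩
      ∑[ w < m ] ∑[ x < m ] multiplicity _≟²_ (v , u) (L w x)   ∎

module _ {n : ℕ} (G : Graph n) where

  infix 4 _~_
  _~_ : Fin n → Fin n → Set
  v ~ u = T (adj G v u)

  ~-sym : ∀ {v u} → v ~ u → u ~ v
  ~-sym {v} {u} = subst T (adj-sym G v u)

  ~-irrefl : ∀ {v u} → v ~ u → v ≢ u
  ~-irrefl {v} v~v refl = subst T (irrefl G v) v~v

  degree-∑ : ∀ v → degree G v ≡ ∑[ u < n ] bit (adj G v u)
  degree-∑ v = listSum-allFin (bit ∘ adj G v)

  3≤degree : ∀ {v a b c} → v ~ a → v ~ b → v ~ c → a ≢ b → a ≢ c → b ≢ c → 3 ≤ degree G v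
  3≤degree {v} {a} {b} {c} v~a v~b v~c a≢b a≢c b≢c = begin
    3                                                   ≡⟨ sym (cong₂ _+_ (cong₂ _+_ (bit-T v~a) (bit-T v~b)) (bit-T v~c)) ⟩
    bit (adj G v a) + bit (adj G v b) + bit (adj G v c) ≤⟨ triple≤∑ (bit ∘ adj G v) a≢b a≢c b≢c ⟩
    ∑[ u < n ] bit (adj G v u)                          ≡⟨ sym (degree-∑ v) ⟩
    degree G v                                          ∎
    where open ≤-Reasoning

  degree≤1 : ∀ {v} p → (∀ u → v ~ u → u ≡ p) → degree G v ≤ 1
  degree≤1 {v} p only-p = begin
    degree G v                   ≡⟨ degree-∑ v ⟩
    ∑[ u < n ] bit (adj G v u)   ≡⟨ ∑-single (bit ∘ adj G v) p non-neighbour ⟩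
    bit (adj G v p)              ≤⟨ bit≤1 _ ⟩
    1                            ∎
    where
    open ≤-Reasoning
    non-neighbour : ∀ u → u ≢ p → bit (adj G v u) ≡ 0
    non-neighbour u u≢p with adj G v u in v~u
    ... | true  = contradiction (only-p u (Equivalence.from T-≡ v~u)) u≢p
    ... | false = refl

  neighbours-of-degree-2 : ∀ {v a b c} → degree G v ≡ 2 → v ~ a → v ~ b → a ≢ b → v ~ c → c ≡ a ⊎ c ≡ b
  neighbours-of-degree-2 {v} {a} {b} {c} deg-v v~a v~b a≢b v~c with c ≟ a | c ≟ b
  ... | yes c≡a | _       = inj₁ c≡a
  ... | no _    | yes c≡b = inj₂ c≡b
  ... | no c≢a  | no c≢b  =
    contradiction (subst (3 ≤_) deg-v (3≤degree v~a v~b v~c a≢b (c≢a ∘ sym) (c≢b ∘ sym))) (λ { (s≤s (s≤s ())) })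

  -- The fallback p is only taken when c has no neighbour besides p.
  other : Fin n → Fin n → Fin n
  other c p with any? (λ q → T? (adj G c q) ×-dec ¬? (q ≟ p))
  ... | yes (q , _) = q
  ... | no _        = p

  other-neighbour : ∀ {c} p → degree G c ≡ 2 → c ~ other c p × other c p ≢ p
  other-neighbour {c} p deg-c with any? (λ q → T? (adj G c q) ×-dec ¬? (q ≟ p))
  ... | yes (q , c~q , q≢p) = c~q , q≢p
  ... | no ∄q = contradiction (subst (_≤ 1) deg-c (degree≤1 p only-p)) (λ { (s≤s ()) })
    where
    only-p : ∀ u → c ~ u → u ≡ p
    only-p u c~u = decidable-stable (u ≟ p) (λ u≢p → ∄q (u , c~u , u≢p))

  other-involutive : ∀ {c p} → degree G c ≡ 2 → c ~ p → other c (other c p) ≡ p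
  other-involutive {c} {p} deg-c c~p
    with other-neighbour p deg-c | other-neighbour (other c p) deg-c
  ... | c~q , q≢p | c~r , r≢q with neighbours-of-degree-2 deg-c c~p c~q (q≢p ∘ sym) c~r
  ...   | inj₁ r≡p = r≡p
  ...   | inj₂ r≡q = contradiction r≡q r≢q

  -- Non-backtracking trails through vertices of degree 2

  Arc : Set
  Arc = Fin n × Fin n

  advance : Arc → Arc
  advance (p , c) = c , other c p

  reversedTrail : ℕ → Arc → List Arc
  reversedTrail s b = applyUpTo (swap ∘ iterate advance b) s

  module Trail {v u : Fin n} (v~u : v ~ u) where

    arc : ℕ → Arc
    arc zero    = v , u
    arc (suc k) = advance (arc k)

    y : ℕ → Fin n
    y k = proj₁ (arc k)

    Degree2Below : ℕ → Set
    Degree2Below t = ∀ k → k < t → degree G (y k) ≡ 2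

    Degree2Below-≤ : ∀ {s t} → s ≤ t → Degree2Below t → Degree2Below s
    Degree2Below-≤ s≤t D k k<s = D k (<-≤-trans k<s s≤t)

    y~y-suc : ∀ k → degree G (y k) ≡ 2 → y k ~ y (suc k)
    y~y-suc zero    _     = v~u
    y~y-suc (suc k) deg-y = proj₁ (other-neighbour _ deg-y)

    y-suc-suc≢y : ∀ k → degree G (y (suc k)) ≡ 2 → y (suc (suc k)) ≢ y k
    y-suc-suc≢y k deg-y = proj₂ (other-neighbour _ deg-y)

    advance-swap : ∀ k → degree G (y k) ≡ 2 → degree G (y (suc k)) ≡ 2 →
      advance (swap (arc (suc k))) ≡ swap (arc k)
    advance-swap k deg-y deg-y′ = cong (y (suc k) ,_) (other-involutive deg-y′ (~-sym (y~y-suc k deg-y)))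

    iterate-advance-swap : ∀ k j → Degree2Below (suc (k + j)) →
      iterate advance (swap (arc (k + j))) k ≡ swap (arc j)
    iterate-advance-swap zero    j _ = refl
    iterate-advance-swap (suc k) j D = begin
      iterate advance (advance (swap (arc (suc (k + j))))) k
        ≡⟨ cong (λ a → iterate advance a k) (advance-swap (k + j) (D _ (m<n⇒m<1+n (n<1+n _))) (D _ (n<1+n _))) ⟩
      iterate advance (swap (arc (k + j))) k
        ≡⟨ iterate-advance-swap k j (λ i i<1+k+j → D i (m<n⇒m<1+n i<1+k+j)) ⟩
      swap (arc j) ∎
      where open ≡-Reasoning

    repetition-gap : ∀ {i j} → Degree2Below (suc j) → i < j → y i ≡ y j → 3 + i ≤ j
    repetition-gap {i} D i<j yi≡yj with m≤n⇒m<n∨m≡n i<j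
    ... | inj₂ refl = contradiction yi≡yj (~-irrefl (y~y-suc i (D i (m<n⇒m<1+n i<j))))
    ... | inj₁ 1+i<j with m≤n⇒m<n∨m≡n 1+i<j
    ...   | inj₂ refl = contradiction (sym yi≡yj) (y-suc-suc≢y i (D (suc i) (s≤s i<j)))
    ...   | inj₁ 2+i<j = 2+i<j

    -- Past the start, y i already has the two neighbours y (i - 1) and y (i + 1),
    -- so y (j - 1) cannot be a third one.
    repetition-at-start : ∀ {i j} → Degree2Below (suc j) → DistinctBelow y j → i < j → y i ≡ y j → i ≡ 0
    repetition-at-start {zero}          _ _        _   _     = refl
    repetition-at-start {suc i} {suc j} D distinct i<j yi≡yj =
      ⊥-elim ([ distinct (≤-pred i<j) (n<1+n j) ∘ sym , distinct 2+i<j (n<1+n j) ∘ sym ]′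
        (neighbours-of-degree-2 deg-y[1+i] (~-sym (y~y-suc i deg-y[i])) (y~y-suc (suc i) deg-y[1+i])
          (y-suc-suc≢y i deg-y[1+i] ∘ sym) (~-sym y[j]~y[1+i])))
      where
      deg-y[i] : degree G (y i) ≡ 2
      deg-y[i] = D i (<-trans (n<1+n i) (m<n⇒m<1+n i<j))
      deg-y[1+i] : degree G (y (suc i)) ≡ 2
      deg-y[1+i] = D (suc i) (m<n⇒m<1+n i<j)
      y[j]~y[1+i] : y j ~ y (suc i)
      y[j]~y[1+i] = subst (y j ~_) (sym yi≡yj) (y~y-suc j (D j (m<n⇒m<1+n (n<1+n j))))
      2+i<j : 2 + i < j
      2+i<j = ≤-pred (repetition-gap D i<j yi≡yj)

    -- The vertices y 0, …, y j are closed under adjacency, hence exhaust G.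
    closed-trail-is-cycle : ∀ {j} → 0 < j → Connected G → Degree2Below (suc j) → DistinctBelow y j →
      y 0 ≡ y j → IsCycle G
    closed-trail-is-cycle {suc j} 0<j conn D distinct y0≡yj =
      conn , λ w → degree-on-trail (reach (conn (y 0) w) (0 , 0<j , refl))
      where
      OnTrail : Fin n → Set
      OnTrail z = ∃[ m ] (m < suc j × y m ≡ z)

      1<j : 1 < j
      1<j = ≤-pred (repetition-gap D 0<j y0≡yj)

      closed : ∀ {z r} → OnTrail z → z ~ r → OnTrail r
      closed (zero , _ , refl) y0~r
        with neighbours-of-degree-2 (D 0 z<s) (y~y-suc 0 (D 0 z<s))
               (~-sym (subst (y j ~_) (sym y0≡yj) (y~y-suc j (D j (m<n⇒m<1+n (n<1+n j))))))
               (distinct 1<j (n<1+n j)) y0~r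
      ... | inj₁ refl = 1 , s≤s (<⇒≤ 1<j) , refl
      ... | inj₂ refl = j , n<1+n j , refl
      closed (suc m , m<j , refl) ym~r
        with neighbours-of-degree-2 (D (suc m) (m<n⇒m<1+n m<j))
               (~-sym (y~y-suc m (D m (<-trans (n<1+n m) (m<n⇒m<1+n m<j)))))
               (y~y-suc (suc m) (D (suc m) (m<n⇒m<1+n m<j)))
               (y-suc-suc≢y m (D (suc m) (m<n⇒m<1+n m<j)) ∘ sym) ym~r
      ... | inj₁ refl = m , <-trans (n<1+n m) m<j , refl
      ... | inj₂ refl with m≤n⇒m<n∨m≡n m<j
      ...   | inj₁ 2+m<j = suc (suc m) , 2+m<j , refl
      ...   | inj₂ refl = 0 , 0<j , y0≡yj

      reach : ∀ {z w} → Walk G z w → OnTrail z → OnTrail w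
      reach here               on-z = on-z
      reach (step z~z′ walk) on-z = reach walk (closed on-z z~z′)

      degree-on-trail : ∀ {w} → OnTrail w → degree G w ≡ 2
      degree-on-trail (m , m<j , refl) = D m (m<n⇒m<1+n m<j)

    distinct-trail-path : ∀ {t} → Degree2Below t → DistinctBelow y t → HasDeg2Path G t
    distinct-trail-path {t} D distinct = f , injective , consecutive , λ i → D (toℕ i) (toℕ<n i)
      where
      f : Fin t → Fin n
      f i = y (toℕ i)

      injective : ∀ {a b} → f a ≡ f b → a ≡ b
      injective {a} {b} fa≡fb with <-cmp a b
      ... | tri< a<b _ _ = contradiction fa≡fb (distinct a<b (toℕ<n b))
      ... | tri≈ _ a≡b _ = a≡b
      ... | tri> _ _ b<a = contradiction (sym fa≡fb) (distinct b<a (toℕ<n a))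

      consecutive : ∀ a b → toℕ b ≡ suc (toℕ a) → f a ~ f b
      consecutive a b b≡1+a =
        subst (λ k → f a ~ y k) (sym b≡1+a) (y~y-suc (toℕ a) (D (toℕ a) (toℕ<n a)))

    degree-2-trail-exits : ∀ {t} → Connected G → ¬ IsCycle G → ¬ HasDeg2Path G t → ¬ Degree2Below t
    degree-2-trail-exits {t} conn ¬cycle ¬path D with first-repetition _≟_ y t
    ... | inj₁ distinct = ¬path (distinct-trail-path D distinct)
    ... | inj₂ (j , i , i<j , j<t , distinct , yi≡yj)
      with repetition-at-start (Degree2Below-≤ j<t D) distinct i<j yi≡yj
    ...   | refl = ¬cycle (closed-trail-is-cycle i<j conn (Degree2Below-≤ j<t D) distinct yi≡yj)

    exit-retraces-start : ∀ {s} → Connected G → ¬ IsCycle G → ¬ HasDeg2Path G (suc s) → degree G v ≡ 2 →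
      ∃₂ λ w x → degree G w ≢ 2 × w ~ x × (v , u) ∈ reversedTrail s (w , x)
    exit-retraces-start {s} conn ¬cycle ¬path deg-v
      with all<-or-least-failure (λ k → degree G (y k) ≟ℕ 2) (suc s)
    ... | inj₁ D = contradiction D (degree-2-trail-exits conn ¬cycle ¬path)
    ... | inj₂ (zero , _ , _ , ¬deg-v) = contradiction deg-v ¬deg-v
    ... | inj₂ (suc k , 1+k<1+s , D , ¬deg) =
      y (suc k) , y k , ¬deg , ~-sym (y~y-suc k (D k (n<1+n k))) ,
      subst (_∈ reversedTrail s (swap (arc k))) retrace
        (∈-applyUpTo⁺ (swap ∘ iterate advance (swap (arc k))) (≤-pred 1+k<1+s))
      where
      retrace : swap (iterate advance (swap (arc k)) k) ≡ (v , u)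
      retrace = subst (λ i → swap (iterate advance (swap (arc i)) k) ≡ (v , u)) (+-identityʳ k)
        (cong swap (iterate-advance-swap k 0 (Degree2Below-≤ (≤-reflexive (cong suc (+-identityʳ k))) D)))

  -- Counting arcs

  hasDegree2 : Fin n → Bool
  hasDegree2 v = degree G v ≡ᵇ 2

  arcsFrom : (Fin n → Bool) → ℕ
  arcsFrom S = ∑[ v < n ] ∑[ u < n ] bit (S v ∧ adj G v u)

  arcsFrom-degree : ∀ S → arcsFrom S ≡ ∑[ v < n ] (bit (S v) * degree G v)
  arcsFrom-degree S = sum-cong-≗ λ v → begin
    ∑[ u < n ] bit (S v ∧ adj G v u)         ≡⟨ sum-cong-≗ (λ u → bit-∧ (S v) (adj G v u)) ⟩
    ∑[ u < n ] (bit (S v) * bit (adj G v u)) ≡⟨ sym (*-distribˡ-sum (bit (S v)) (bit ∘ adj G v)) ⟩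
    bit (S v) * ∑[ u < n ] bit (adj G v u)   ≡⟨ cong (bit (S v) *_) (sym (degree-∑ v)) ⟩
    bit (S v) * degree G v                   ∎
    where open ≡-Reasoning

  boundaryTrails : ℕ → Fin n → Fin n → List Arc
  boundaryTrails s w x = if not (hasDegree2 w) ∧ adj G w x then reversedTrail s (w , x) else []

  length-boundaryTrails : ∀ s w x → length (boundaryTrails s w x) ≤ s * bit (not (hasDegree2 w) ∧ adj G w x)
  length-boundaryTrails s w x with not (hasDegree2 w) ∧ adj G w x
  ... | true  = ≤-reflexive (trans (length-applyUpTo _ s) (sym (*-identityʳ s)))
  ... | false = z≤n

  boundaryTrails-≡ : ∀ s {w x} → degree G w ≢ 2 → w ~ x → boundaryTrails s w x ≡ reversedTrail s (w , x)
  boundaryTrails-≡ s {w} {x} ¬deg w~x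
    rewrite dec-false (degree G w ≟ℕ 2) ¬deg | Equivalence.to T-≡ w~x = refl

  degree-2-arcs≤ : ∀ {s} → Connected G → ¬ IsCycle G → ¬ HasDeg2Path G (suc s) →
    arcsFrom hasDegree2 ≤ s * arcsFrom (not ∘ hasDegree2)
  degree-2-arcs≤ {s} conn ¬cycle ¬path = begin
    arcsFrom hasDegree2
      ≤⟨ double-counting (λ v u → hasDegree2 v ∧ adj G v u) (boundaryTrails s) covered ⟩
    ∑[ w < n ] ∑[ x < n ] length (boundaryTrails s w x)
      ≤⟨ ∑-mono-≤ (λ w → ∑-mono-≤ (length-boundaryTrails s w)) ⟩
    ∑[ w < n ] ∑[ x < n ] (s * bit (not (hasDegree2 w) ∧ adj G w x))
      ≡⟨ sum-cong-≗ (λ w → sym (*-distribˡ-sum s (λ x → bit (not (hasDegree2 w) ∧ adj G w x)))) ⟩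
    ∑[ w < n ] (s * ∑[ x < n ] bit (not (hasDegree2 w) ∧ adj G w x))
      ≡⟨ sym (*-distribˡ-sum s (λ w → ∑[ x < n ] bit (not (hasDegree2 w) ∧ adj G w x))) ⟩
    s * arcsFrom (not ∘ hasDegree2) ∎
    where
    open ≤-Reasoning
    covered : ∀ v u → T (hasDegree2 v ∧ adj G v u) → ∃₂ λ w x → (v , u) ∈ boundaryTrails s w x
    covered v u deg2∧v~u with Equivalence.to T-∧ deg2∧v~u
    ... | deg2 , v~u with Trail.exit-retraces-start v~u conn ¬cycle ¬path (≡ᵇ⇒≡ _ 2 deg2)
    ...   | w , x , ¬deg , w~x , vu∈trail = w , x , subst ((v , u) ∈_) (sym (boundaryTrails-≡ s ¬deg w~x)) vu∈trail

  degree-sum-split : ∑[ v < n ] degree G v ≡ arcsFrom hasDegree2 + arcsFrom (not ∘ hasDegree2)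
  degree-sum-split = begin
    ∑[ v < n ] degree G v
      ≡⟨ sum-cong-≗ (λ v → bit-*-split (hasDegree2 v) (degree G v)) ⟩
    ∑[ v < n ] (bit (hasDegree2 v) * degree G v + bit (not (hasDegree2 v)) * degree G v)
      ≡⟨ ∑-distrib-+ (λ v → bit (hasDegree2 v) * degree G v) (λ v → bit (not (hasDegree2 v)) * degree G v) ⟩
    ∑[ v < n ] (bit (hasDegree2 v) * degree G v) + ∑[ v < n ] (bit (not (hasDegree2 v)) * degree G v)
      ≡⟨ sym (cong₂ _+_ (arcsFrom-degree hasDegree2) (arcsFrom-degree (not ∘ hasDegree2))) ⟩
    arcsFrom hasDegree2 + arcsFrom (not ∘ hasDegree2) ∎
    where open ≡-Reasoning

  arcsFrom-hasDegree2 : arcsFrom hasDegree2 ≡ 2 * d2 G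
  arcsFrom-hasDegree2 = begin
    arcsFrom hasDegree2                            ≡⟨ arcsFrom-degree hasDegree2 ⟩
    ∑[ v < n ] (bit (hasDegree2 v) * degree G v)   ≡⟨ sum-cong-≗ (λ v → bit-≡ᵇ2-* (degree G v)) ⟩
    ∑[ v < n ] (2 * bit (hasDegree2 v))            ≡⟨ sym (*-distribˡ-sum 2 (bit ∘ hasDegree2)) ⟩
    2 * ∑[ v < n ] bit (hasDegree2 v)              ≡⟨ cong (2 *_) (sym (listSum-allFin (bit ∘ hasDegree2))) ⟩
    2 * d2 G                                       ∎
    where open ≡-Reasoning

  3*d≥3≤arcsFrom : 3 * d≥3 G ≤ arcsFrom (not ∘ hasDegree2)
  3*d≥3≤arcsFrom = begin
    3 * d≥3 G                                               ≡⟨ cong (3 *_) (listSum-allFin (λ v → bit (3 ≤ᵇ degree G v))) ⟩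
    3 * ∑[ v < n ] bit (3 ≤ᵇ degree G v)                    ≡⟨ *-distribˡ-sum 3 (λ v → bit (3 ≤ᵇ degree G v)) ⟩
    ∑[ v < n ] (3 * bit (3 ≤ᵇ degree G v))                  ≤⟨ ∑-mono-≤ (λ v → 3*bit-3≤ᵇ≤ (degree G v)) ⟩
    ∑[ v < n ] (bit (not (hasDegree2 v)) * degree G v)      ≡⟨ sym (arcsFrom-degree (not ∘ hasDegree2)) ⟩
    arcsFrom (not ∘ hasDegree2)                             ∎
    where open ≤-Reasoning

  bit-adj-split : ∀ v u → bit (adj G v u) ≡ bit (adj G v u ∧ does (v <? u)) + bit (adj G v u ∧ does (u <? v))
  bit-adj-split v u with adj G v u in v~u
  ... | false = refl
  ... | true with <-cmp v u
  ...   | tri< v<u _ u≮v = sym (cong₂ _+_ (bit-does-yes (v <? u) v<u) (bit-does-no (u <? v) u≮v))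
  ...   | tri≈ _ v≡u _   = contradiction v≡u (~-irrefl (Equivalence.from T-≡ v~u))
  ...   | tri> v≮u _ u<v = sym (cong₂ _+_ (bit-does-no (v <? u) v≮u) (bit-does-yes (u <? v) u<v))

  handshake : ∑[ v < n ] degree G v ≡ 2 * edgeCount G
  handshake = begin
    ∑[ v < n ] degree G v
      ≡⟨ sum-cong-≗ (λ v → trans (degree-∑ v) (sum-cong-≗ (bit-adj-split v))) ⟩
    ∑[ v < n ] ∑[ u < n ] (bit (adj G v u ∧ does (v <? u)) + bit (adj G v u ∧ does (u <? v)))
      ≡⟨ trans (sum-cong-≗ (λ v → ∑-distrib-+ (λ u → bit (adj G v u ∧ does (v <? u))) (λ u → bit (adj G v u ∧ does (u <? v)))))
               (∑-distrib-+ (λ v → ∑[ u < n ] bit (adj G v u ∧ does (v <? u))) (λ v → ∑[ u < n ] bit (adj G v u ∧ does (u <? v)))) ⟩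
    ∑[ v < n ] ∑[ u < n ] bit (adj G v u ∧ does (v <? u)) + ∑[ v < n ] ∑[ u < n ] bit (adj G v u ∧ does (u <? v))
      ≡⟨ cong (∑[ v < n ] ∑[ u < n ] bit (adj G v u ∧ does (v <? u)) +_)
           (trans (∑-comm (λ v u → bit (adj G v u ∧ does (u <? v))))
                  (sum-cong-≗ (λ u → sum-cong-≗ (λ v → cong (λ b → bit (b ∧ does (u <? v))) (adj-sym G v u))))) ⟩
    ∑[ v < n ] ∑[ u < n ] bit (adj G v u ∧ does (v <? u)) + ∑[ u < n ] ∑[ v < n ] bit (adj G u v ∧ does (u <? v))
      ≡⟨ cong₂ _+_ (sym edgeCount-∑) (trans (sym edgeCount-∑) (sym (+-identityʳ (edgeCount G)))) ⟩
    2 * edgeCount G ∎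
    where
    open ≡-Reasoning
    edgeCount-∑ : edgeCount G ≡ ∑[ v < n ] ∑[ u < n ] bit (adj G v u ∧ does (v <? u))
    edgeCount-∑ = trans (listSum-allFin (λ v → List.sum (map (λ u → bit (adj G v u ∧ does (v <? u))) (allFin n))))
      (sum-cong-≗ (λ v → listSum-allFin (λ u → bit (adj G v u ∧ does (v <? u)))))

edge-bound-arithmetic : ∀ s d₂ d₃ e a → 2 * d₂ ≤ s * a → 3 * d₃ ≤ a → 2 * e ≡ 2 * d₂ + a →
  (4 * suc s + 1) * (d₂ + d₃) ≤ 4 * suc s * e
edge-bound-arithmetic s d₂ d₃ e a 2d₂≤sa 3d₃≤a 2e≡2d₂+a = *-cancelˡ-≤ 6 (begin
  6 * ((4 * t + 1) * (d₂ + d₃))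
    ≡⟨ expand-left s d₂ d₃ ⟩
  4 * t * (6 * d₂) + 3 * (2 * d₂) + (8 * t + 2) * (3 * d₃)
    ≤⟨ +-mono-≤ (+-monoʳ-≤ (4 * t * (6 * d₂)) (*-monoʳ-≤ 3 2d₂≤sa)) (*-monoʳ-≤ (8 * t + 2) 3d₃≤a) ⟩
  4 * t * (6 * d₂) + 3 * (s * a) + (8 * t + 2) * a
    ≤⟨ m≤m+n _ ((s + 2) * a) ⟩
  4 * t * (6 * d₂) + 3 * (s * a) + (8 * t + 2) * a + (s + 2) * a
    ≡⟨ collect s d₂ a ⟩
  3 * (4 * t * (2 * d₂ + a))
    ≡⟨ cong (λ m → 3 * (4 * t * m)) (sym 2e≡2d₂+a) ⟩
  3 * (4 * t * (2 * e))
    ≡⟨ expand-right s e ⟩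
  6 * (4 * t * e) ∎)
  where
  open ≤-Reasoning
  t : ℕ
  t = suc s
  expand-left : ∀ s d₂ d₃ → 6 * ((4 * suc s + 1) * (d₂ + d₃)) ≡
    4 * suc s * (6 * d₂) + 3 * (2 * d₂) + (8 * suc s + 2) * (3 * d₃)
  expand-left = solve-∀
  collect : ∀ s d₂ a → 4 * suc s * (6 * d₂) + 3 * (s * a) + (8 * suc s + 2) * a + (s + 2) * a ≡
    3 * (4 * suc s * (2 * d₂ + a))
  collect = solve-∀
  expand-right : ∀ s e → 3 * (4 * suc s * (2 * e)) ≡ 6 * (4 * suc s * e)
  expand-right = solve-∀

lemma7 : (t : ℕ) → 2 ≤ t → (n : ℕ) (G : Graph n) →
    Connected G → ¬ IsCycle G → ¬ HasDeg2Path G t →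
    (4 * t + 1) * (d2 G + d≥3 G) ≤ 4 * t * edgeCount G
lemma7 (suc s) _ n G conn ¬cycle ¬path =
  edge-bound-arithmetic s (d2 G) (d≥3 G) (edgeCount G) a 2d₂≤sa (3*d≥3≤arcsFrom G) 2e≡2d₂+a
  where
  open ≡-Reasoning
  a : ℕ
  a = arcsFrom G (not ∘ hasDegree2 G)
  2d₂≤sa : 2 * d2 G ≤ s * a
  2d₂≤sa = subst (_≤ s * a) (arcsFrom-hasDegree2 G) (degree-2-arcs≤ G conn ¬cycle ¬path)
  2e≡2d₂+a : 2 * edgeCount G ≡ 2 * d2 G + a
  2e≡2d₂+a = begin
    2 * edgeCount G                    ≡⟨ sym (handshake G) ⟩
    ∑[ v < n ] degree G v              ≡⟨ degree-sum-split G ⟩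
    arcsFrom G (hasDegree2 G) + a      ≡⟨ cong (_+ a) (arcsFrom-hasDegree2 G) ⟩
    2 * d2 G + a                       ∎
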